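{- Let $G$, $\mathcal{H}=(L,H)$, the edges $e_1,\ldots,e_l$, and the sets $S_i$, $B_i$ be as in the context. Suppose $\{e_{i_1},\ldots,e_{i_p}\} \subseteq E(G)$ and the spanning subgraph $G'$ of $G$ with edge set $\{e_{i_1},\ldots,e_{i_p}\}$ has $c$ components. Then $$-m^c \leq \left|\bigcap_{j=1}^p S_{i_j}\right| - \left|\bigcap_{j=1}^p B_{i_j}\right| \leq 0.$$
   Context: Let $G=\Theta(l_1,\ldots,l_k)$ (two end vertices $u,w$ joined by $k$ internally disjoint paths of lengths $l_1,\ldots,l_k$), where $k\ge 2$, $l_2\le\cdots\le l_k$, $l_2\ge\max\{l_1,2\}$, and $l_1$ has different parity from $l_j$ for every $j\in\{2,\ldots,k\}$. The vertices of the $i$th path are $u, v_{i,1},\ldots,v_{i,l_i-1},w$ (if $l_1=1$, $v_{1,1}$ means $w$). Let $l=\sum_{i=1}^k l_i=|E(G)|$ and $n=l+2-k=|V(G)|$. For $i\in[k]$ let $e_i=uv_{i,1}$, and name the remaining edges so that $E(G)=\{e_i: i\in[l]\}$; write $e_i=y_iz_i$. Let $m\in\mathbb{N}$. A cover of $G$ is a pair $\mathcal{H}=(L,H)$ with $H$ a graph and $L:V(G)\to\mathcal{P}(V(H))$ such that $\{L(x)\}$ partitions $V(H)$, each $H[L(x)]$ is complete, edges of $H$ between $L(x)$ and $L(y)$ for $x\ne y$ exist only if $xy\in E(G)$, and for $xy\in E(G)$ the set $E_H(L(x),L(y))$ of such edges is a matching; it is $m$-fold if all $|L(x)|=m$,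 and full if each such matching for $xy\in E(G)$ is perfect. Here $\mathcal{H}=(L,H)$ is a full $m$-fold cover of $G$ with $L(x)=\{(x,j):j\in[m]\}$ for each $x\in V(G)$ and $(x,j)(y,j)\in E(H)$ for every $xy\in E(G)\setminus\{e_2,\ldots,e_k\}$ and $j\in[m]$. Let $\mathcal{U}=\{I\subseteq V(H): |L(x)\cap I|=1 \text{ for all } x\in V(G)\}$. For $i\in[l]$, $S_i$ is the set of $I\in\mathcal{U}$ such that $H[I]$ contains an edge of $E_H(L(y_i),L(z_i))$, and $B_i$ is the set of all maps $V(G)\to[m]$ that give $y_i$ and $z_i$ the same value. -}

module Defs where

open import Data.Nat using (ℕ; zero; suc; _+_; _∸_; _≤_; _<_; _<?_; z≤n; s≤s)
open import Data.Nat.Properties using (≤-trans; +-monoʳ-<; +-monoʳ-≤; +-assoc; m≤m+n; ∸-monoˡ-≤; ≤-reflexive)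
open import Data.Fin using (Fin; zero; suc; toℕ; fromℕ<)
open import Data.Fin.Permutation using (Permutation′; _⟨$⟩ʳ_)
open import Data.Vec.Functional using (_∷_)
open import Data.Product using (Σ; _×_; _,_; ∃)
open import Data.List using (List)
open import Data.List.Membership.Propositional using (_∈_)
open import Data.List.Relation.Unary.All using (All; all?)
open import Relation.Nullary using (Dec; yes; no; does)
open import Relation.Binary.PropositionalEquality using (_≡_; sym; cong)
open import Data.Bool using (if_then_else_)
open import Function using (_∘_)
import Data.Fin.Properties as FinP

sumF : ∀ {k} → (Fin k → ℕ) → ℕ
sumF {zero}  f = 0
sumF {suc k} f = f zero + sumF (f ∘ suc)

offset : ∀ {k} → (Fin k → ℕ) → Fin k → ℕ
offset {suc k} f zero    = 0
offset {suc k} f (suc i) = f zero + offset (f ∘ suc) i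

offset-bound : ∀ {k} (f : Fin k → ℕ) (i : Fin k) → offset f i + f i ≤ sumF f
offset-bound {suc k} f zero = m≤m+n (f zero) _
offset-bound {suc k} f (suc i) =
  ≤-trans (≤-reflexive (+-assoc (f zero) (offset (f ∘ suc) i) (f (suc i))))
          (+-monoʳ-≤ (f zero) (offset-bound (f ∘ suc) i))

-- The theta graph Θ(l₁,…,l_k).
-- Paths are indexed by Fin k (index zero = the paper's path 1).
-- Vertices are Fin (nV l):  0 = u, 1 = w, and the inner vertex
-- v_{i,t} (1 ≤ t ≤ l_i - 1) is  2 + offset i + (t - 1).

nInner : ∀ {k} → (Fin k → ℕ) → ℕ
nInner l = sumF (λ i → l i ∸ 1)

nV : ∀ {k} → (Fin k → ℕ) → ℕ
nV l = 2 + nInner l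

vu : ∀ {k} {l : Fin k → ℕ} → Fin (nV l)
vu = zero

vw : ∀ {k} {l : Fin k → ℕ} → Fin (nV l)
vw = suc zero

-- inner vertex v_{i,s+1}, given s < l_i - 1
inner : ∀ {k} (l : Fin k → ℕ) (i : Fin k) (s : ℕ) → s < l i ∸ 1 → Fin (nV l)
inner l i s p = fromℕ< {2 + (offset (λ j → l j ∸ 1) i + s)}
  (s≤s (s≤s (≤-trans (+-monoʳ-< (offset (λ j → l j ∸ 1) i) p)
                     (offset-bound (λ j → l j ∸ 1) i))))

-- pos l i s : the s-th vertex (0 ≤ s ≤ l_i) along the i-th path from u to w
pos : ∀ {k} (l : Fin k → ℕ) (i : Fin k) → ℕ → Fin (nV l)
pos l i zero = vu {l = l}
pos l i (suc s) with suc s <? l i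
... | yes p = inner l i s (∸-monoˡ-≤ 1 p)
... | no _  = vw {l = l}

-- Edges: (i , t) is the t-th edge (t = 0 … l_i - 1) of path i, joining
-- pos i t and pos i (t+1).  The paper's e_i (i ∈ [k]) = u v_{i,1} is (i , 0).
Edge : ∀ {k} → (Fin k → ℕ) → Set
Edge {k} l = Σ (Fin k) (λ i → Fin (l i))

yE : ∀ {k} (l : Fin k → ℕ) → Edge l → Fin (nV l)
yE l (i , t) = pos l i (toℕ t)

zE : ∀ {k} (l : Fin k → ℕ) → Edge l → Fin (nV l)
zE l (i , t) = pos l i (suc (toℕ t))

-- The full m-fold cover H.  L(x) = {(x,j) : j ∈ [m]}.  For every edge other
-- than e_2,…,e_k the matching is (y,j)(z,j); for e_{i} (i = 2..k, i.e. path
-- index suc i') the (perfect) matching between L(u) and L(v_{i,1}) is a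
-- permutation σ i' : (u,a)(v_{i,1}, σ i' a).
-- CrossEdge σ e a b  :⇔  (y_e , a)(z_e , b) ∈ E(H).

CrossEdge : ∀ {k m} {l : Fin (suc (suc k)) → ℕ} → (Fin (suc k) → Permutation′ m) →
            Edge l → Fin m → Fin m → Set
CrossEdge σ (zero  , t) a b = b ≡ a
CrossEdge σ (suc i , t) a b with toℕ t
... | zero  = b ≡ σ i ⟨$⟩ʳ a
... | suc _ = b ≡ a

CrossEdge? : ∀ {k m} {l : Fin (suc (suc k)) → ℕ} (σ : Fin (suc k) → Permutation′ m)
             (e : Edge l) (a b : Fin m) → Dec (CrossEdge {l = l} σ e a b)
CrossEdge? σ (zero  , t) a b = b FinP.≟ a
CrossEdge? σ (suc i , t) a b with toℕ t
... | zero  = b FinP.≟ σ i ⟨$⟩ʳ a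
... | suc _ = b FinP.≟ a

-- Elements I ∈ 𝒰 are identified with maps f : V(G) → [m]
-- (I = {(x , f x) : x ∈ V(G)}).
-- I ∈ S_e  iff  H[I] contains an edge of E_H(L(y_e), L(z_e)).
InS : ∀ {k m} (l : Fin (suc (suc k)) → ℕ) → (Fin (suc k) → Permutation′ m) →
      Edge l → (Fin (nV l) → Fin m) → Set
InS l σ e f = CrossEdge {l = l} σ e (f (yE l e)) (f (zE l e))

InB : ∀ {k m} (l : Fin k → ℕ) → Edge l → (Fin (nV l) → Fin m) → Set
InB l e f = f (yE l e) ≡ f (zE l e)

-- Counting: countFun n P P? = |{ f : Fin n → Fin m | P f }|

countFun : ∀ n {m} (P : (Fin n → Fin m) → Set) → (∀ f → Dec (P f)) → ℕ
countFun zero     P P? = if does (P? (λ ())) then 1 else 0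
countFun (suc n) {m} P P? =
  sumF {m} (λ a → countFun n (λ g → P (a ∷ g)) (λ g → P? (a ∷ g)))

countS : ∀ {k m} (l : Fin (suc (suc k)) → ℕ) → (Fin (suc k) → Permutation′ m) →
         List (Edge l) → ℕ
countS {m = m} l σ es =
  countFun (nV l) {m} (λ f → All (λ e → InS l σ e f) es)
    (λ f → all? (λ e → CrossEdge? {l = l} σ e (f (yE l e)) (f (zE l e))) es)

countB : ∀ {k} (l : Fin k → ℕ) (m : ℕ) → List (Edge l) → ℕ
countB l m es =
  countFun (nV l) {m} (λ f → All (λ e → InB l e f) es)
    (λ f → all? (λ e → f (yE l e) FinP.≟ f (zE l e)) es)

data Reach {k} (l : Fin k → ℕ) (es : List (Edge l)) (x : Fin (nV l)) : Fin (nV l) → Set where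
  here : Reach l es x x
  fwd  : ∀ {e} → e ∈ es → Reach l es x (yE l e) → Reach l es x (zE l e)
  bwd  : ∀ {e} → e ∈ es → Reach l es x (zE l e) → Reach l es x (yE l e)

-- G' has exactly c components: there is a surjective labelling of the
-- vertices by Fin c whose fibres are exactly the reachability classes.
HasComponents : ∀ {k} (l : Fin k → ℕ) → List (Edge l) → ℕ → Set
HasComponents l es c =
  Σ (Fin (nV l) → Fin c) λ comp →
    (∀ j → ∃ λ x → comp x ≡ j) ×
    (∀ x y → comp x ≡ comp y → Reach l es x y) ×
    (∀ x y → Reach l es x y → comp x ≡ comp y)

-- A labelling f : V(G) → [m] lies in ⋂ S_e exactly when it respects every matching of H along
-- the chosen edges, and in ⋂ B_e when it respects the identity matching along them.  Both kinds of
-- matching are bijections, so such a labelling is determined on each component of G' by its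
-- value at one vertex: restricting to a transversal of the components injects either set into
-- the m^c labellings of the components.  Conversely every labelling of the components, composed
-- with the component map, lies in ⋂ B_e.  Hence |⋂ S_e| ≤ m^c = |⋂ B_e|.
module Submission where

open import Defs
open import Data.Bool using (if_then_else_)
open import Data.Empty using (⊥-elim)
open import Data.Fin using (Fin; zero; suc; toℕ; _↑ˡ_; _↑ʳ_; splitAt)
import Data.Fin as F
open import Data.Fin.Permutation using (Permutation′; _⟨$⟩ʳ_)
import Data.Fin.Permutation as Perm
open import Data.Fin.Properties using (join-splitAt; splitAt-↑ˡ; splitAt-↑ʳ; injective⇒≤; _≟_)
open import Data.Integer using (+_; _-_; -_; +≤+) renaming (_≤_ to _≤ℤ_)
open import Data.Integer.Properties using (neg-mono-≤; i≤j⇒i≤k+j; i≤j⇒i-j≤0)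
  renaming (≤-trans to ≤ℤ-trans; ≤-refl to ≤ℤ-refl)
open import Data.List using (List)
open import Data.List.Relation.Unary.All as All using (All; all?)
open import Data.Nat using (ℕ; zero; suc; _+_; _*_; _^_; _≤_; _%_)
open import Data.Nat.Properties using (≤-trans)
open import Data.Product using (Σ; _×_; _,_; proj₁; proj₂)
open import Data.Sum using (inj₁; inj₂)
open import Data.Unit using (⊤; tt)
open import Data.Vec.Functional using (_∷_)
open import Data.Vec.Functional.Properties using (∷-cong)
open import Function using (_∘_)
open import Function.Bundles using (Injection)
open import Function.Properties.Inverse using (↔⇒↣)
open import Level using (0ℓ)
open import Relation.Nullary using (Dec; yes; no; does)
open import Relation.Binary.PropositionalEquality
open import Relation.Unary using (Pred; Decidable)

sumF-inject : ∀ {m} (h : Fin m → ℕ) → Σ (Fin m) (Fin ∘ h) → Fin (sumF h)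
sumF-inject {suc m} h (zero  , x) = x ↑ˡ sumF (h ∘ suc)
sumF-inject {suc m} h (suc a , x) = h zero ↑ʳ sumF-inject (h ∘ suc) (a , x)

sumF-split : ∀ {m} (h : Fin m → ℕ) → Fin (sumF h) → Σ (Fin m) (Fin ∘ h)
sumF-split {suc m} h i with splitAt (h zero) i
... | inj₁ x = zero , x
... | inj₂ j = let (a , x) = sumF-split (h ∘ suc) j in suc a , x

sumF-split-inject : ∀ {m} (h : Fin m → ℕ) s → sumF-split h (sumF-inject h s) ≡ s
sumF-split-inject {suc m} h (zero , x)
  rewrite splitAt-↑ˡ (h zero) x (sumF (h ∘ suc)) = refl
sumF-split-inject {suc m} h (suc a , x)
  rewrite splitAt-↑ʳ (h zero) (sumF (h ∘ suc)) (sumF-inject (h ∘ suc) (a , x))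
        | sumF-split-inject (h ∘ suc) (a , x) = refl

sumF-inject-split : ∀ {m} (h : Fin m → ℕ) i → sumF-inject h (sumF-split h i) ≡ i
sumF-inject-split {suc m} h i with splitAt (h zero) i | join-splitAt (h zero) (sumF (h ∘ suc)) i
... | inj₁ x | eq = eq
... | inj₂ j | eq = trans (cong (h zero ↑ʳ_) (sumF-inject-split (h ∘ suc) j)) eq

sumF-split-injective : ∀ {m} (h : Fin m → ℕ) {i j} → sumF-split h i ≡ sumF-split h j → i ≡ j
sumF-split-injective h {i} {j} eq = begin
  i                              ≡⟨ sym (sumF-inject-split h i) ⟩
  sumF-inject h (sumF-split h i) ≡⟨ cong (sumF-inject h) eq ⟩
  sumF-inject h (sumF-split h j) ≡⟨ sumF-inject-split h j ⟩
  j                              ∎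
  where open ≡-Reasoning

sumF-const : ∀ m x → sumF {m} (λ _ → x) ≡ m * x
sumF-const zero    x = refl
sumF-const (suc m) x = cong (λ y → x + y) (sumF-const m x)

Indicator : ∀ {A : Set} → Dec A → Set
Indicator d = Fin (if does d then 1 else 0)

indicator-irrelevant : ∀ {A : Set} (d : Dec A) (i j : Indicator d) → i ≡ j
indicator-irrelevant (yes _) zero zero = refl

indicator-toWitness : ∀ {A : Set} (d : Dec A) → Indicator d → A
indicator-toWitness (yes a) _ = a

indicator-fromWitness : ∀ {A : Set} (d : Dec A) → A → Indicator d
indicator-fromWitness (yes _) _ = zero
indicator-fromWitness (no ¬a) a = ⊥-elim (¬a a)

-- Needed because countFun 0 decides P at one fixed empty function, which is not definitionally
-- equal to other functions out of Fin 0.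
Extensional : ∀ {n m} → ((Fin n → Fin m) → Set) → Set
Extensional P = ∀ {f g} → f ≗ g → P f → P g

Extensional-∷ : ∀ {n m} {P : (Fin (suc n) → Fin m) → Set} →
                Extensional P → ∀ a → Extensional (λ g → P (a ∷ g))
Extensional-∷ ext a eq = ext (∷-cong refl eq)

module _ {m : ℕ} where

  private
    Property : ℕ → Set₁
    Property n = Pred (Fin n → Fin m) 0ℓ

  countFibre : ∀ n (P : Property (suc n)) → Decidable P → Fin m → ℕ
  countFibre n P P? a = countFun n (λ g → P (a ∷ g)) (λ g → P? (a ∷ g))

  enumerate : ∀ n (P : Property n) (P? : Decidable P) → Fin (countFun n P P?) → Fin n → Fin m
  enumerate-fibre : ∀ n (P : Property (suc n)) (P? : Decidable P) →
                    Σ (Fin m) (Fin ∘ countFibre n P P?) → Fin (suc n) → Fin m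

  enumerate zero    P P? _ ()
  enumerate (suc n) P P? i = enumerate-fibre n P P? (sumF-split (countFibre n P P?) i)

  enumerate-fibre n P P? (a , j) = a ∷ enumerate n (λ g → P (a ∷ g)) (λ g → P? (a ∷ g)) j

  enumerate-sound : ∀ n (P : Property n) (P? : Decidable P) → Extensional P →
                    ∀ i → P (enumerate n P P? i)
  enumerate-sound zero P P? ext i = ext (λ ()) (indicator-toWitness (P? (λ ())) i)
  enumerate-sound (suc n) P P? ext i with sumF-split (countFibre n P P?) i
  ... | a , j = enumerate-sound n (λ g → P (a ∷ g)) (λ g → P? (a ∷ g)) (Extensional-∷ ext a) j

  enumerate-injective : ∀ n (P : Property n) (P? : Decidable P) i j →
                        enumerate n P P? i ≗ enumerate n P P? j → i ≡ j
  enumerate-fibre-injective : ∀ n (P : Property (suc n)) (P? : Decidable P) s t →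
                              enumerate-fibre n P P? s ≗ enumerate-fibre n P P? t → s ≡ t

  enumerate-injective zero    P P? i j _  = indicator-irrelevant (P? (λ ())) i j
  enumerate-injective (suc n) P P? i j eq =
    sumF-split-injective (countFibre n P P?) (enumerate-fibre-injective n P P? _ _ eq)

  enumerate-fibre-injective n P P? (a , i) (b , j) eq with eq zero
  ... | refl = cong (a ,_) (enumerate-injective n _ _ i j (eq ∘ suc))

  index : ∀ n (P : Property n) (P? : Decidable P) → Extensional P →
          (f : Fin n → Fin m) → P f → Fin (countFun n P P?)
  index zero    P P? ext f p = indicator-fromWitness (P? (λ ())) (ext (λ ()) p)
  index (suc n) P P? ext f p = sumF-inject (countFibre n P P?)
    (f zero , index n (λ g → P (f zero ∷ g)) (λ g → P? (f zero ∷ g)) (Extensional-∷ ext (f zero))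
                    (f ∘ suc) (ext (∷-cong refl λ _ → refl) p))

  enumerate-index : ∀ n (P : Property n) (P? : Decidable P) (ext : Extensional P) f (p : P f) →
                    enumerate n P P? (index n P P? ext f p) ≗ f
  enumerate-index zero    P P? ext f p ()
  enumerate-index (suc n) P P? ext f p x =
    trans (cong (λ s → enumerate-fibre n P P? s x) (sumF-split-inject (countFibre n P P?) _)) (on x)
    where
    on : ∀ x → enumerate-fibre n P P? (f zero , _) x ≡ f x
    on zero    = refl
    on (suc x) = enumerate-index n (λ g → P (f zero ∷ g)) (λ g → P? (f zero ∷ g))
                                 (Extensional-∷ ext (f zero)) (f ∘ suc) _ x

countFun-≤ : ∀ {n n′ m m′} {P : (Fin n → Fin m) → Set} {Q : (Fin n′ → Fin m′) → Set}
             (P? : ∀ f → Dec (P f)) (Q? : ∀ f → Dec (Q f)) →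
             Extensional P → Extensional Q →
             (F : (Fin n → Fin m) → Fin n′ → Fin m′) → (∀ {f} → P f → Q (F f)) →
             (∀ {f g} → P f → P g → F f ≗ F g → f ≗ g) →
             countFun n P P? ≤ countFun n′ Q Q?
countFun-≤ {n} {n′} {P = P} {Q} P? Q? extP extQ F F-maps F-injective =
  injective⇒≤ {f = φ} φ-injective
  where
  φ : Fin (countFun n P P?) → Fin (countFun n′ Q Q?)
  φ i = index n′ Q Q? extQ (F (enumerate n P P? i)) (F-maps (enumerate-sound n P P? extP i))

  φ-injective : ∀ {i j} → φ i ≡ φ j → i ≡ j
  φ-injective {i} {j} eq = enumerate-injective n P P? i j
    (F-injective (enumerate-sound n P P? extP i) (enumerate-sound n P P? extP j) λ x →
      trans (sym (enumerate-index n′ Q Q? extQ _ _ x))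
        (trans (cong (λ k → enumerate n′ Q Q? k x) eq) (enumerate-index n′ Q Q? extQ _ _ x)))

countFun-⊤ : ∀ m c → countFun c {m} (λ _ → ⊤) (λ _ → yes tt) ≡ m ^ c
countFun-⊤ m zero    = refl
countFun-⊤ m (suc c) =
  trans (cong (λ x → sumF {m} (λ _ → x)) (countFun-⊤ m c)) (sumF-const m (m ^ c))

record IsMatching {A B : Set} (R : A → B → Set) : Set where
  field
    functional : ∀ {a b b′} → R a b → R a b′ → b ≡ b′
    injective  : ∀ {a a′ b} → R a b → R a′ b → a ≡ a′

≡-isMatching : ∀ {A : Set} → IsMatching {A} _≡_
≡-isMatching = record { functional = λ p q → trans (sym p) q ; injective = λ p q → trans p (sym q) }

permutation-isMatching : ∀ {m} (π : Permutation′ m) → IsMatching (λ a b → b ≡ π ⟨$⟩ʳ a)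
permutation-isMatching π = record
  { functional = λ p q → trans p (sym q)
  ; injective  = λ p q → Injection.injective (↔⇒↣ π) (trans (sym p) q)
  }

CrossEdge-isMatching : ∀ {k m} {l : Fin (suc (suc k)) → ℕ} (σ : Fin (suc k) → Permutation′ m) →
                       ∀ e → IsMatching (CrossEdge {l = l} σ e)
CrossEdge-isMatching σ (zero , t) = permutation-isMatching Perm.id
CrossEdge-isMatching σ (suc i , t) with toℕ t
... | zero  = permutation-isMatching (σ i)
... | suc _ = permutation-isMatching Perm.id

module _ {k m : ℕ} (l : Fin k → ℕ) (R : Edge l → Fin m → Fin m → Set) where

  Compatible : List (Edge l) → (Fin (nV l) → Fin m) → Set
  Compatible es f = All (λ e → R e (f (yE l e)) (f (zE l e))) es

  compatible? : (∀ e a b → Dec (R e a b)) → ∀ es → Decidable (Compatible es)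
  compatible? R? es f = all? (λ e → R? e (f (yE l e)) (f (zE l e))) es

  countCompatible : (∀ e a b → Dec (R e a b)) → List (Edge l) → ℕ
  countCompatible R? es = countFun (nV l) (Compatible es) (compatible? R? es)

  Compatible-extensional : ∀ es → Extensional (Compatible es)
  Compatible-extensional es eq = All.map λ {e} → subst₂ (R e) (eq (yE l e)) (eq (zE l e))

  module _ (matching : ∀ e → IsMatching (R e)) where
    open IsMatching

    Compatible-agree-along-Reach : ∀ {es f g x y} → Compatible es f → Compatible es g →
                                   f x ≡ g x → Reach l es x y → f y ≡ g y
    Compatible-agree-along-Reach cf cg fx≡gx here = fx≡gx
    Compatible-agree-along-Reach {g = g} cf cg fx≡gx (fwd {e} e∈es r) =
      functional (matching e) (All.lookup cf e∈es)
        (subst (λ a → R e a (g (zE l e))) (sym fy≡gy) (All.lookup cg e∈es))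
      where fy≡gy = Compatible-agree-along-Reach cf cg fx≡gx r
    Compatible-agree-along-Reach {g = g} cf cg fx≡gx (bwd {e} e∈es r) =
      injective (matching e) (All.lookup cf e∈es)
        (subst (R e (g (yE l e))) (sym fz≡gz) (All.lookup cg e∈es))
      where fz≡gz = Compatible-agree-along-Reach cf cg fx≡gx r

    countCompatible-≤ : ∀ R? {es c} → HasComponents l es c → countCompatible R? es ≤ m ^ c
    countCompatible-≤ R? {es} {c} (comp , surj , toReach , _) =
      subst (_ ≤_) (countFun-⊤ m c)
        (countFun-≤ (compatible? R? es) (λ _ → yes tt) (Compatible-extensional es) (λ _ _ → tt)
          (λ f → f ∘ rep) (λ _ → tt)
          (λ cf cg eq x → Compatible-agree-along-Reach cf cg (eq (comp x))
                            (toReach _ x (proj₂ (surj (comp x))))))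
      where
      rep : Fin c → Fin (nV l)
      rep j = proj₁ (surj j)

^≤countB : ∀ {k} (l : Fin k → ℕ) m {es c} → HasComponents l es c → m ^ c ≤ countB l m es
^≤countB l m {es} {c} (comp , surj , _ , fromReach) =
  subst (_≤ _) (countFun-⊤ m c)
    (countFun-≤ (λ _ → yes tt) (compatible? l (λ _ → _≡_) (λ _ → _≟_) es)
      (λ _ _ → tt) (Compatible-extensional l (λ _ → _≡_) es)
      (λ r → r ∘ comp)
      (λ {r} _ → All.tabulate λ e∈es → cong r (fromReach _ _ (fwd e∈es here)))
      (λ {r} {r′} _ _ eq j → subst (λ i → r i ≡ r′ i) (proj₂ (surj j)) (eq (rep j))))
  where
  rep : Fin c → Fin (nV l)
  rep j = proj₁ (surj j)

difference-bounds : ∀ {a b M} → a ≤ M → b ≤ M → M ≤ b →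
                    (- (+ M) ≤ℤ (+ a) - (+ b)) × ((+ a) - (+ b) ≤ℤ + 0)
difference-bounds a≤M b≤M M≤b =
  ≤ℤ-trans (neg-mono-≤ (+≤+ b≤M)) (i≤j⇒i≤k+j (+ _) ≤ℤ-refl) ,
  i≤j⇒i-j≤0 (+≤+ (≤-trans a≤M M≤b))

lemma3p3 : ∀ {k} (l : Fin (suc (suc k)) → ℕ) →
           1 ≤ l zero →
           (∀ (i j : Fin (suc k)) → i F.≤ j → l (suc i) ≤ l (suc j)) →
           l zero ≤ l (suc zero) → 2 ≤ l (suc zero) →
           (∀ (j : Fin (suc k)) → l zero % 2 ≢ l (suc j) % 2) →
           (m : ℕ) (σ : Fin (suc k) → Permutation′ m) →
           (es : List (Edge l)) (c : ℕ) → HasComponents l es c →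
           (- (+ (m ^ c)) ≤ℤ (+ countS l σ es) - (+ countB l m es)) ×
           ((+ countS l σ es) - (+ countB l m es) ≤ℤ + 0)
lemma3p3 l _ _ _ _ _ m σ es c components =
  difference-bounds
    (countCompatible-≤ l (CrossEdge σ) (CrossEdge-isMatching σ) (CrossEdge? σ) components)
    (countCompatible-≤ l (λ _ → _≡_) (λ _ → ≡-isMatching) (λ _ → _≟_) components)
    (^≤countB l m components)
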